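{- Let $n\ge1$ and let $v$ be a factor of $\mathbf{t}$. Write $(i,j,k)=\Psi(\mathbf{t}^<_{n-1})$ and $(i',j',k')=\Psi(v)$. Suppose that either (a) $|v|\ge n$ and ($i'\le i-1$ or $j'\le j-1$), or (b) $|v|\le n$ and ($i'\ge i+2$ or $j'\ge j+2$). Then $\rho(n)>3$.
   Context: Let $\tau$ be the morphism on $\{0,1,2\}^*$ given by $0\mapsto 01$, $1\mapsto 02$, $2\mapsto 0$, and let $\mathbf{t}=\lim_{n\to\infty}\tau^n(0)$ be its fixed point (the Tribonacci word). A factor is a finite block of consecutive letters of $\mathbf{t}$. For a word $u$, $\Psi(u)=(|u|_0,|u|_1,|u|_2)$ is its Parikh vector, $|u|_a$ being the number of occurrences of $a$. $\rho(n)$ is the number of distinct Parikh vectors of factors of $\mathbf{t}$ of length $n$. A factor $u$ is right special if $ua$ and $ub$ are factors for two distinct letters $a,b$; it is known that for each $n\ge1$, $\mathbf{t}$ has exactly one right special factor of length $n-1$, denoted $\mathbf{t}^<_{n-1}$. -}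

module Defs where

open import Data.Nat using (ℕ; zero; suc; _+_)
open import Data.Fin using (Fin)
open import Data.List using (List; []; _∷_; _++_; length; map; upTo; lookup)
open import Data.Product using (_×_; _,_; ∃; ∃-syntax; Σ-syntax; proj₁; proj₂)
open import Relation.Binary.PropositionalEquality using (_≡_; _≢_)

data Letter : Set where
  l0 l1 l2 : Letter

τ : Letter → List Letter
τ l0 = l0 ∷ l1 ∷ []
τ l1 = l0 ∷ l2 ∷ []
τ l2 = l0 ∷ []

τ* : List Letter → List Letter
τ* [] = []
τ* (a ∷ u) = τ a ++ τ* u

τpow0 : ℕ → List Letter
τpow0 zero = l0 ∷ []
τpow0 (suc k) = τ* (τpow0 k)

-- the m-th letter (0-indexed) of a list, with default l0 outside the range
at : List Letter → ℕ → Letter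
at [] _ = l0
at (a ∷ u) zero = a
at (a ∷ u) (suc m) = at u m

-- The Tribonacci word t = lim τ^k(0): its m-th letter is the m-th letter of
-- τ^(m+1)(0), which has length > m and is a prefix of all later τ^k(0).
t : ℕ → Letter
t m = at (τpow0 (suc m)) m

factorAt : ℕ → ℕ → List Letter
factorAt p n = map (λ j → t (p + j)) (upTo n)

IsFactor : List Letter → Set
IsFactor u = ∃[ p ] (factorAt p (length u) ≡ u)

RightSpecial : List Letter → Set
RightSpecial u = ∃[ a ] ∃[ b ] (a ≢ b × IsFactor (u ++ a ∷ []) × IsFactor (u ++ b ∷ []))

count : Letter → List Letter → ℕ
count a [] = 0
count l0 (l0 ∷ u) = suc (count l0 u)
count l1 (l1 ∷ u) = suc (count l1 u)
count l2 (l2 ∷ u) = suc (count l2 u)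
count a (_ ∷ u) = count a u

Ψ : List Letter → ℕ × ℕ × ℕ
Ψ u = count l0 u , count l1 u , count l2 u

-- ρ(n) ≥ m : there are at least m distinct Parikh vectors of factors of
-- length n, i.e. m factors of length n (given by starting positions) with
-- pairwise distinct Parikh vectors.
ρ≥ : ℕ → ℕ → Set
ρ≥ n m = Σ[ f ∈ (Fin m → ℕ) ] ((a b : Fin m) → Ψ (factorAt (f a) n) ≡ Ψ (factorAt (f b) n) → a ≡ b)

Ψ₀ Ψ₁ : List Letter → ℕ
Ψ₀ u = proj₁ (Ψ u)
Ψ₁ u = proj₁ (proj₂ (Ψ u))

-- The right special factor w is followed by all three letters. If w ended in 1 or 2 its next
-- letter would be forced to be 0, so w = w₀0; an occurrence of w₀0a desubstitutes under τ to an
-- occurrence of w′c with τ(c) beginning with 0a, where the shorter word w′ is determined by w₀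
-- alone. So w′ is again followed by two letters, by induction by all three, and applying τ to
-- w′cd yields w₀0a for every a. The Parikh vectors of w0, w1, w2 are pairwise distinct and give
-- each letter x the count |w|ₓ or |w|ₓ + 1, while the hypothesis on v puts the count of 0 or of
-- 1 in the length-n factor at the position of v outside that range: a fourth Parikh vector.
module Submission where

open import Defs
open import Data.Nat using (ℕ; zero; suc; _+_; _∸_; _≤_; _<_; _≤′_; ≤′-refl; ≤′-step; z≤n; s≤s)
open import Data.Nat.Properties
open import Data.Nat.Induction using (<-wellFounded)
open import Data.Fin using (Fin)
import Data.Fin as F
open import Data.List using (List; []; _∷_; _++_; _∷ʳ_; length; applyUpTo; initLast; _∷ʳ′_)
open import Data.List.Properties using (∷-injectiveˡ; ∷-injectiveʳ; ++-assoc; ++-identityʳ; length-++; map-upTo)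
open import Data.Product using (_×_; _,_; ∃-syntax; proj₁; proj₂)
open import Data.Sum using (_⊎_; inj₁; inj₂)
open import Data.Empty using (⊥-elim)
open import Function using (_on_)
open import Induction.WellFounded using (WellFounded; Acc; acc)
import Relation.Binary.Construct.On as On
open import Relation.Binary.PropositionalEquality

private variable
  a b c ℓ : Letter
  u u′ v s w₀ y : List Letter

Infix : List Letter → List Letter → Set
Infix u s = ∃[ L ] ∃[ R ] (s ≡ L ++ u ++ R)

infix-trans : Infix u v → Infix v s → Infix u s
infix-trans {u} {v} {s} (L , R , e) (L′ , R′ , e′) = L′ ++ L , R ++ R′ ,
  (begin
    s                          ≡⟨ e′ ⟩
    L′ ++ v ++ R′              ≡⟨ cong (λ r → L′ ++ r ++ R′) e ⟩
    L′ ++ (L ++ u ++ R) ++ R′  ≡⟨ cong (L′ ++_) (++-assoc L (u ++ R) R′) ⟩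
    L′ ++ L ++ (u ++ R) ++ R′  ≡⟨ cong (λ r → L′ ++ L ++ r) (++-assoc u R R′) ⟩
    L′ ++ L ++ u ++ R ++ R′    ≡⟨ ++-assoc L′ L (u ++ R ++ R′) ⟨
    (L′ ++ L) ++ u ++ R ++ R′  ∎)
  where open ≡-Reasoning

infix-∷ʳ : ∀ L R → s ≡ L ++ u ++ c ∷ R → Infix (u ∷ʳ c) s
infix-∷ʳ {u = u} {c = c} L R e = L , R , trans e (cong (L ++_) (sym (++-assoc u (c ∷ []) R)))

∷ʳ-∷ʳ-++ : ∀ (w : List Letter) ℓ a R → ((w ∷ʳ ℓ) ∷ʳ a) ++ R ≡ w ++ ℓ ∷ a ∷ R
∷ʳ-∷ʳ-++ w ℓ a R = trans (++-assoc (w ∷ʳ ℓ) (a ∷ []) R) (++-assoc w (ℓ ∷ []) (a ∷ R))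

τ*-++ : ∀ x y → τ* (x ++ y) ≡ τ* x ++ τ* y
τ*-++ [] y = refl
τ*-++ (a ∷ x) y = trans (cong (τ a ++_) (τ*-++ x y)) (sym (++-assoc (τ a) (τ* x) (τ* y)))

infix-τ* : Infix u s → Infix (τ* u) (τ* s)
infix-τ* {u} (L , R , refl) = τ* L , τ* R , trans (τ*-++ L (u ++ R)) (cong (τ* L ++_) (τ*-++ u R))

τ*-head : ∀ {a R} X → a ∷ R ≡ τ* X → a ≡ l0
τ*-head [] ()
τ*-head (l0 ∷ X) e = ∷-injectiveˡ e
τ*-head (l1 ∷ X) e = ∷-injectiveˡ e
τ*-head (l2 ∷ X) e = ∷-injectiveˡ e

τ*-∷ : ∀ d z → ∃[ r ] (τ* (d ∷ z) ≡ l0 ∷ r)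
τ*-∷ l0 z = _ , refl
τ*-∷ l1 z = _ , refl
τ*-∷ l2 z = _ , refl

-- In a τ-image the letter after the leading 0 of a block τ(c) is next c, whatever follows.
next : Letter → Letter
next l0 = l1
next l1 = l2
next l2 = l0

prev : Letter → Letter
prev l0 = l2
prev l1 = l0
prev l2 = l1

next-prev : ∀ c → next (prev c) ≡ c
next-prev l0 = refl
next-prev l1 = refl
next-prev l2 = refl

τ*-∷-∷ : ∀ c d z → ∃[ r ] (τ* (c ∷ d ∷ z) ≡ l0 ∷ next c ∷ r)
τ*-∷-∷ l0 d z = _ , refl
τ*-∷-∷ l1 d z = _ , refl
τ*-∷-∷ l2 d z = let r , e = τ*-∷ d z in r , cong (l0 ∷_) e

τ*-after0 : ∀ {a R} X → l0 ∷ a ∷ R ≡ τ* X → ∃[ c ] ∃[ Z ] (X ≡ c ∷ Z × next c ≡ a)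
τ*-after0 [] ()
τ*-after0 (l0 ∷ Z) e = l0 , Z , refl , sym (∷-injectiveˡ (∷-injectiveʳ e))
τ*-after0 (l1 ∷ Z) e = l1 , Z , refl , sym (∷-injectiveˡ (∷-injectiveʳ e))
τ*-after0 (l2 ∷ Z) e = l2 , Z , refl , sym (τ*-head Z (∷-injectiveʳ e))

-- A cut of τ*(X) either falls between two blocks or inside a block τ(0) = 0|1 or τ(1) = 0|2.
data Cut : Set where
  boundary inside₀ inside₁ : Cut

cutBlock cutLeft cutRight : Cut → List Letter
cutBlock boundary = []
cutBlock inside₀ = l0 ∷ []
cutBlock inside₁ = l1 ∷ []
cutLeft boundary = []
cutLeft inside₀ = l0 ∷ []
cutLeft inside₁ = l0 ∷ []
cutRight boundary = []
cutRight inside₀ = l1 ∷ []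
cutRight inside₁ = l2 ∷ []

τ*-cutBlock : ∀ q → τ* (cutBlock q) ≡ cutLeft q ++ cutRight q
τ*-cutBlock boundary = refl
τ*-cutBlock inside₀ = refl
τ*-cutBlock inside₁ = refl

τ*-split : ∀ X L M → τ* X ≡ L ++ M →
  ∃[ X₁ ] ∃[ q ] ∃[ X₂ ] (X ≡ X₁ ++ cutBlock q ++ X₂ × L ≡ τ* X₁ ++ cutLeft q × M ≡ cutRight q ++ τ* X₂)
τ*-split X [] M e = [] , boundary , X , refl , refl , sym e
τ*-split [] (_ ∷ _) M ()
τ*-split (l0 ∷ X) (_ ∷ []) M e = [] , inside₀ , X , refl , cong (_∷ []) (sym (∷-injectiveˡ e)) , sym (∷-injectiveʳ e)
τ*-split (l1 ∷ X) (_ ∷ []) M e = [] , inside₁ , X , refl , cong (_∷ []) (sym (∷-injectiveˡ e)) , sym (∷-injectiveʳ e)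
τ*-split (l0 ∷ X) (_ ∷ _ ∷ L) M e with τ*-split X L M (∷-injectiveʳ (∷-injectiveʳ e))
... | X₁ , q , X₂ , eX , eL , eM =
  l0 ∷ X₁ , q , X₂ , cong (l0 ∷_) eX , cong₂ _∷_ (sym (∷-injectiveˡ e)) (cong₂ _∷_ (sym (∷-injectiveˡ (∷-injectiveʳ e))) eL) , eM
τ*-split (l1 ∷ X) (_ ∷ _ ∷ L) M e with τ*-split X L M (∷-injectiveʳ (∷-injectiveʳ e))
... | X₁ , q , X₂ , eX , eL , eM =
  l1 ∷ X₁ , q , X₂ , cong (l1 ∷_) eX , cong₂ _∷_ (sym (∷-injectiveˡ e)) (cong₂ _∷_ (sym (∷-injectiveˡ (∷-injectiveʳ e))) eL) , eM
τ*-split (l2 ∷ X) (_ ∷ L) M e with τ*-split X L M (∷-injectiveʳ e)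
... | X₁ , q , X₂ , eX , eL , eM = l2 ∷ X₁ , q , X₂ , cong (l2 ∷_) eX , cong₂ _∷_ (sym (∷-injectiveˡ e)) eL , eM

τ*-split-before0 : ∀ X L {M} → τ* X ≡ L ++ l0 ∷ M →
  ∃[ X₁ ] ∃[ X₂ ] (X ≡ X₁ ++ X₂ × L ≡ τ* X₁ × l0 ∷ M ≡ τ* X₂)
τ*-split-before0 X L e with τ*-split X L _ e
... | X₁ , boundary , X₂ , eX , eL , eM = X₁ , X₂ , eX , trans eL (++-identityʳ (τ* X₁)) , eM
... | _ , inside₀ , _ , _ , _ , ()
... | _ , inside₁ , _ , _ , _ , ()

τ*-after-nonzero : ∀ X L {R} → ℓ ≢ l0 → τ* X ≡ L ++ ℓ ∷ a ∷ R → a ≡ l0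
τ*-after-nonzero X L ℓ≢0 e with τ*-split X L _ e
... | _ , boundary , X₂ , _ , _ , eM = ⊥-elim (ℓ≢0 (τ*-head X₂ eM))
... | _ , inside₀ , X₂ , _ , _ , eM = τ*-head X₂ (∷-injectiveʳ eM)
... | _ , inside₁ , X₂ , _ , _ , eM = τ*-head X₂ (∷-injectiveʳ eM)

desubstitute : ∀ X L w₀ {a R} → τ* X ≡ L ++ w₀ ++ l0 ∷ a ∷ R →
  ∃[ q ] ∃[ y ] ∃[ c ] (Infix ((cutBlock q ++ y) ∷ʳ c) X × w₀ ≡ cutRight q ++ τ* y × next c ≡ a)
desubstitute X L w₀ e with τ*-split-before0 X (L ++ w₀) (trans e (sym (++-assoc L w₀ _)))
... | X₁ , X₂ , refl , eLw , e0a with τ*-after0 X₂ e0a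
... | c , Z , refl , ec with τ*-split X₁ L w₀ (sym eLw)
... | Y , q , y , refl , _ , ew =
  q , y , c , (Y , Z , reassoc) , ew , ec
  where
  reassoc : (Y ++ cutBlock q ++ y) ++ c ∷ Z ≡ Y ++ ((cutBlock q ++ y) ∷ʳ c) ++ Z
  reassoc = trans (++-assoc Y (cutBlock q ++ y) (c ∷ Z)) (cong (Y ++_) (sym (++-assoc (cutBlock q ++ y) (c ∷ []) Z)))

τ*-injective : ∀ x y → τ* x ≡ τ* y → x ≡ y
τ*-injective [] [] e = refl
τ*-injective [] (l0 ∷ y) ()
τ*-injective [] (l1 ∷ y) ()
τ*-injective [] (l2 ∷ y) ()
τ*-injective (l0 ∷ x) [] ()
τ*-injective (l1 ∷ x) [] ()
τ*-injective (l2 ∷ x) [] ()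
τ*-injective (l0 ∷ x) (l0 ∷ y) e = cong (l0 ∷_) (τ*-injective x y (∷-injectiveʳ (∷-injectiveʳ e)))
τ*-injective (l1 ∷ x) (l1 ∷ y) e = cong (l1 ∷_) (τ*-injective x y (∷-injectiveʳ (∷-injectiveʳ e)))
τ*-injective (l2 ∷ x) (l2 ∷ y) e = cong (l2 ∷_) (τ*-injective x y (∷-injectiveʳ e))
τ*-injective (l0 ∷ x) (l1 ∷ y) e with () ← ∷-injectiveˡ (∷-injectiveʳ e)
τ*-injective (l1 ∷ x) (l0 ∷ y) e with () ← ∷-injectiveˡ (∷-injectiveʳ e)
τ*-injective (l0 ∷ x) (l2 ∷ y) e with () ← τ*-head y (∷-injectiveʳ e)
τ*-injective (l1 ∷ x) (l2 ∷ y) e with () ← τ*-head y (∷-injectiveʳ e)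
τ*-injective (l2 ∷ x) (l0 ∷ y) e with () ← τ*-head x (sym (∷-injectiveʳ e))
τ*-injective (l2 ∷ x) (l1 ∷ y) e with () ← τ*-head x (sym (∷-injectiveʳ e))

cutRight-τ*-injective : ∀ q q′ x y → cutRight q ++ τ* x ≡ cutRight q′ ++ τ* y → q ≡ q′ × x ≡ y
cutRight-τ*-injective boundary boundary x y e = refl , τ*-injective x y e
cutRight-τ*-injective inside₀ inside₀ x y e = refl , τ*-injective x y (∷-injectiveʳ e)
cutRight-τ*-injective inside₁ inside₁ x y e = refl , τ*-injective x y (∷-injectiveʳ e)
cutRight-τ*-injective boundary inside₀ x y e with () ← τ*-head x (sym e)
cutRight-τ*-injective boundary inside₁ x y e with () ← τ*-head x (sym e)
cutRight-τ*-injective inside₀ boundary x y e with () ← τ*-head y e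
cutRight-τ*-injective inside₁ boundary x y e with () ← τ*-head y e
cutRight-τ*-injective inside₀ inside₁ x y ()
cutRight-τ*-injective inside₁ inside₀ x y ()

length-τ* : ∀ x → length x ≤ length (τ* x)
length-τ* [] = z≤n
length-τ* (l0 ∷ x) = ≤-trans (s≤s (length-τ* x)) (n≤1+n _)
length-τ* (l1 ∷ x) = ≤-trans (s≤s (length-τ* x)) (n≤1+n _)
length-τ* (l2 ∷ x) = s≤s (length-τ* x)

length-desubstitute : ∀ q x → length (cutBlock q ++ x) ≤ length (cutRight q ++ τ* x)
length-desubstitute boundary x = length-τ* x
length-desubstitute inside₀ x = s≤s (length-τ* x)
length-desubstitute inside₁ x = s≤s (length-τ* x)

τpow0-step : ∀ k → ∃[ d ] ∃[ z ] (τpow0 (suc k) ≡ τpow0 k ++ d ∷ z)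
τpow0-step zero = l1 , [] , refl
τpow0-step (suc k) with τpow0-step k
... | d , z , e with τ*-∷ d z
... | r , er = l0 , r , trans (cong τ* e) (trans (τ*-++ (τpow0 k) (d ∷ z)) (cong (τpow0 (suc k) ++_) er))

τpow0-prefix : ∀ {j k} → j ≤ k → ∃[ z ] (τpow0 k ≡ τpow0 j ++ z)
τpow0-prefix j≤k = go (≤⇒≤′ j≤k)
  where
  go : ∀ {j k} → j ≤′ k → ∃[ z ] (τpow0 k ≡ τpow0 j ++ z)
  go {j} ≤′-refl = [] , sym (++-identityʳ (τpow0 j))
  go {j} (≤′-step {k} j≤′k) with go j≤′k | τpow0-step k
  ... | z , e | d , z′ , e′ = z ++ d ∷ z′ , trans e′ (trans (cong (_++ d ∷ z′) e) (++-assoc (τpow0 j) z (d ∷ z′)))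

length-τpow0 : ∀ k → k < length (τpow0 k)
length-τpow0 zero = s≤s z≤n
length-τpow0 (suc k) with τpow0-step k
... | d , z , e = begin-strict
  suc k                           ≤⟨ length-τpow0 k ⟩
  length (τpow0 k)                <⟨ m<m+n (length (τpow0 k)) (s≤s z≤n) ⟩
  length (τpow0 k) + suc (length z) ≡⟨ length-++ (τpow0 k) ⟨
  length (τpow0 k ++ d ∷ z)       ≡⟨ cong length e ⟨
  length (τpow0 (suc k))          ∎
  where open ≤-Reasoning

-- Factors of t are exactly the infixes of the words τᵏ(0); in this form they are visibly
-- closed under τ and under desubstitution.
IsFactor′ : List Letter → Set
IsFactor′ u = ∃[ k ] Infix u (τpow0 k)

IsFactor′-infix : Infix u′ u → IsFactor′ u → IsFactor′ u′
IsFactor′-infix i (k , j) = k , infix-trans i j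

IsFactor′-τ* : IsFactor′ u → IsFactor′ (τ* u)
IsFactor′-τ* (k , i) = suc k , infix-τ* i

IsFactor′-letter : ∀ c → IsFactor′ (c ∷ [])
IsFactor′-letter l0 = 0 , [] , [] , refl
IsFactor′-letter l1 = 1 , l0 ∷ [] , [] , refl
IsFactor′-letter l2 = 2 , l0 ∷ l1 ∷ l0 ∷ [] , [] , refl

IsFactor′-desubst : IsFactor′ u → ∃[ X ] (IsFactor′ X × Infix u (τ* X))
IsFactor′-desubst (k , i) with τpow0-step k
... | d , z , e = τpow0 k , (k , [] , [] , sym (++-identityʳ (τpow0 k))) , infix-trans i ([] , d ∷ z , e)

IsFactor′-extend : IsFactor′ u → ∃[ d ] IsFactor′ (u ∷ʳ d)
IsFactor′-extend {u} (k , L , R , e) with τpow0-step k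
... | d , z , e′ = extend R (trans e′ (trans (cong (_++ d ∷ z) e) (++-assoc-middle L u R)))
  where
  ++-assoc-middle : ∀ L u R → (L ++ u ++ R) ++ d ∷ z ≡ L ++ u ++ R ++ d ∷ z
  ++-assoc-middle L u R = trans (++-assoc L (u ++ R) (d ∷ z)) (cong (L ++_) (++-assoc u R (d ∷ z)))
  extend : ∀ R → τpow0 (suc k) ≡ L ++ u ++ R ++ d ∷ z → ∃[ d ] IsFactor′ (u ∷ʳ d)
  extend [] e″ = d , suc k , infix-∷ʳ L z e″
  extend (r ∷ R) e″ = r , suc k , infix-∷ʳ L (R ++ d ∷ z) e″

IsFactor′-after-nonzero : ℓ ≢ l0 → IsFactor′ ((w₀ ∷ʳ ℓ) ∷ʳ a) → a ≡ l0
IsFactor′-after-nonzero {ℓ} {w₀} {a} ℓ≢0 f with IsFactor′-desubst f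
... | X , _ , L , R , e = τ*-after-nonzero X (L ++ w₀) ℓ≢0
  (trans e (trans (cong (L ++_) (∷ʳ-∷ʳ-++ w₀ ℓ a R)) (sym (++-assoc L w₀ (ℓ ∷ a ∷ R)))))

IsFactor′-desubst₀ : IsFactor′ ((w₀ ∷ʳ l0) ∷ʳ a) →
  ∃[ q ] ∃[ y ] ∃[ c ] (IsFactor′ ((cutBlock q ++ y) ∷ʳ c) × w₀ ≡ cutRight q ++ τ* y × next c ≡ a)
IsFactor′-desubst₀ {w₀} {a} f with IsFactor′-desubst f
... | X , fX , L , R , e with desubstitute X L w₀ (trans e (cong (L ++_) (∷ʳ-∷ʳ-++ w₀ l0 a R)))
... | q , y , c , i , ew , ec = q , y , c , IsFactor′-infix i fX , ew , ec

IsFactor′-resubst₀ : ∀ q → w₀ ≡ cutRight q ++ τ* y → IsFactor′ ((cutBlock q ++ y) ∷ʳ c) →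
  IsFactor′ ((w₀ ∷ʳ l0) ∷ʳ next c)
IsFactor′-resubst₀ {w₀} {y} {c} q refl f with IsFactor′-extend f
... | d , f′ with τ*-∷-∷ c d []
... | r , er = IsFactor′-infix (cutLeft q , r , image) (IsFactor′-τ* f′)
  where
  B = cutBlock q ++ y
  image : τ* ((B ∷ʳ c) ∷ʳ d) ≡ cutLeft q ++ ((w₀ ∷ʳ l0) ∷ʳ next c) ++ r
  image = begin
    τ* ((B ∷ʳ c) ∷ʳ d)                                      ≡⟨ cong τ* (trans (sym (++-identityʳ _)) (∷ʳ-∷ʳ-++ B c d [])) ⟩
    τ* (B ++ c ∷ d ∷ [])                                    ≡⟨ τ*-++ B (c ∷ d ∷ []) ⟩
    τ* B ++ τ* (c ∷ d ∷ [])                                 ≡⟨ cong₂ _++_ (τ*-++ (cutBlock q) y) er ⟩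
    (τ* (cutBlock q) ++ τ* y) ++ l0 ∷ next c ∷ r            ≡⟨ cong (λ p → (p ++ τ* y) ++ l0 ∷ next c ∷ r) (τ*-cutBlock q) ⟩
    ((cutLeft q ++ cutRight q) ++ τ* y) ++ l0 ∷ next c ∷ r  ≡⟨ cong (_++ l0 ∷ next c ∷ r) (++-assoc (cutLeft q) (cutRight q) (τ* y)) ⟩
    (cutLeft q ++ w₀) ++ l0 ∷ next c ∷ r                    ≡⟨ ++-assoc (cutLeft q) w₀ (l0 ∷ next c ∷ r) ⟩
    cutLeft q ++ w₀ ++ l0 ∷ next c ∷ r                      ≡⟨ cong (cutLeft q ++_) (∷ʳ-∷ʳ-++ w₀ l0 (next c) r) ⟨
    cutLeft q ++ ((w₀ ∷ʳ l0) ∷ʳ next c) ++ r                ∎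
    where open ≡-Reasoning

length-wellFounded : WellFounded (_<_ on length {A = Letter})
length-wellFounded = On.wellFounded length <-wellFounded

twoExtensions⇒allExtensions : ∀ w → Acc (_<_ on length) w → a ≢ b →
  IsFactor′ (w ∷ʳ a) → IsFactor′ (w ∷ʳ b) → ∀ c → IsFactor′ (w ∷ʳ c)
twoExtensions⇒allExtensions w _ a≢b wa wb c with initLast w
... | [] = IsFactor′-letter c
... | w₀ ∷ʳ′ l1 = ⊥-elim (a≢b (trans (IsFactor′-after-nonzero (λ ()) wa) (sym (IsFactor′-after-nonzero (λ ()) wb))))
... | w₀ ∷ʳ′ l2 = ⊥-elim (a≢b (trans (IsFactor′-after-nonzero (λ ()) wa) (sym (IsFactor′-after-nonzero (λ ()) wb))))
twoExtensions⇒allExtensions w (acc shorter) a≢b wa wb c | w₀ ∷ʳ′ l0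
  with IsFactor′-desubst₀ wa | IsFactor′-desubst₀ wb
... | q , y , ca , wa′ , ew , eca | q′ , y′ , cb , wb′ , ew′ , ecb
  with cutRight-τ*-injective q q′ y y′ (trans (sym ew) ew′)
... | refl , refl =
  subst (λ c → IsFactor′ ((w₀ ∷ʳ l0) ∷ʳ c)) (next-prev c) (IsFactor′-resubst₀ q ew (extensions (prev c)))
  where
  w′<w : length (cutBlock q ++ y) < length (w₀ ∷ʳ l0)
  w′<w = begin-strict
    length (cutBlock q ++ y)          ≤⟨ length-desubstitute q y ⟩
    length (cutRight q ++ τ* y)       ≡⟨ cong length ew ⟨
    length w₀                         <⟨ m<m+n (length w₀) (s≤s z≤n) ⟩
    length w₀ + 1                     ≡⟨ length-++ w₀ ⟨
    length (w₀ ∷ʳ l0)                 ∎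
    where open ≤-Reasoning
  extensions : ∀ c → IsFactor′ ((cutBlock q ++ y) ∷ʳ c)
  extensions = twoExtensions⇒allExtensions (cutBlock q ++ y) (shorter w′<w)
    (λ ca≡cb → a≢b (trans (sym eca) (trans (cong next ca≡cb) ecb))) wa′ wb′

at-++ˡ : ∀ x y {m} → m < length x → at (x ++ y) m ≡ at x m
at-++ˡ (_ ∷ x) y {zero} _ = refl
at-++ˡ (_ ∷ x) y {suc m} (s≤s m<|x|) = at-++ˡ x y m<|x|

at-++ʳ : ∀ x y j → at (x ++ y) (length x + j) ≡ at y j
at-++ʳ [] y j = refl
at-++ʳ (_ ∷ x) y j = at-++ʳ x y j

applyUpTo-++ : ∀ {A : Set} (f : ℕ → A) m n → applyUpTo f (m + n) ≡ applyUpTo f m ++ applyUpTo (λ j → f (m + j)) n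
applyUpTo-++ f zero n = refl
applyUpTo-++ f (suc m) n = cong (f 0 ∷_) (applyUpTo-++ (λ j → f (suc j)) m n)

applyUpTo-prefix : ∀ (f : ℕ → Letter) n x → n ≤ length x → (∀ m → m < n → at x m ≡ f m) →
  ∃[ R ] (x ≡ applyUpTo f n ++ R)
applyUpTo-prefix f zero x _ _ = x , refl
applyUpTo-prefix f (suc n) (y ∷ x) (s≤s n≤|x|) agree
  with applyUpTo-prefix (λ j → f (suc j)) n x n≤|x| (λ m m<n → agree (suc m) (s≤s m<n))
... | R , e = R , cong₂ _∷_ (agree 0 (s≤s z≤n)) e

applyUpTo-at : ∀ (f : ℕ → Letter) x → (∀ j → j < length x → f j ≡ at x j) → applyUpTo f (length x) ≡ x
applyUpTo-at f [] _ = refl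
applyUpTo-at f (y ∷ x) agree =
  cong₂ _∷_ (agree 0 (s≤s z≤n)) (applyUpTo-at (λ j → f (suc j)) x (λ j j<|x| → agree (suc j) (s≤s j<|x|)))

t≡at-τpow0 : ∀ {m} k → m < length (τpow0 k) → t m ≡ at (τpow0 k) m
t≡at-τpow0 {m} k m<|τᵏ0| with ≤-total (suc m) k
... | inj₁ m<k = let z , e = τpow0-prefix m<k in
  sym (trans (cong (λ x → at x m) e) (at-++ˡ (τpow0 (suc m)) z (<⇒≤ (length-τpow0 (suc m)))))
... | inj₂ k≤1+m = let z , e = τpow0-prefix k≤1+m in
  trans (cong (λ x → at x m) e) (at-++ˡ (τpow0 k) z m<|τᵏ0|)

factorAt-applyUpTo : ∀ p n → factorAt p n ≡ applyUpTo (λ j → t (p + j)) n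
factorAt-applyUpTo p = map-upTo (λ j → t (p + j))

IsFactor′-factorAt : ∀ p n → IsFactor′ (factorAt p n)
IsFactor′-factorAt p n with applyUpTo-prefix t (p + n) (τpow0 (p + n)) |τᵏ0|-bound
                              (λ m m<p+n → sym (t≡at-τpow0 (p + n) (<-≤-trans m<p+n |τᵏ0|-bound)))
  where |τᵏ0|-bound = <⇒≤ (length-τpow0 (p + n))
... | R , e = p + n , applyUpTo t p , R , (begin
  τpow0 (p + n)                                           ≡⟨ e ⟩
  applyUpTo t (p + n) ++ R                                ≡⟨ cong (_++ R) (applyUpTo-++ t p n) ⟩
  (applyUpTo t p ++ applyUpTo (λ j → t (p + j)) n) ++ R   ≡⟨ ++-assoc (applyUpTo t p) _ R ⟩
  applyUpTo t p ++ applyUpTo (λ j → t (p + j)) n ++ R     ≡⟨ cong (λ f → applyUpTo t p ++ f ++ R) (factorAt-applyUpTo p n) ⟨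
  applyUpTo t p ++ factorAt p n ++ R                      ∎)
  where open ≡-Reasoning

IsFactor⇒IsFactor′ : IsFactor u → IsFactor′ u
IsFactor⇒IsFactor′ (p , e) = subst IsFactor′ e (IsFactor′-factorAt p _)

IsFactor′⇒IsFactor : IsFactor′ u → IsFactor u
IsFactor′⇒IsFactor {u} (k , L , R , e) = length L , trans (factorAt-applyUpTo (length L) (length u)) (applyUpTo-at _ u agree)
  where
  inside : ∀ {j} → j < length u → length L + j < length (L ++ u ++ R)
  inside {j} j<|u| = begin-strict
    length L + j                     <⟨ +-monoʳ-< (length L) j<|u| ⟩
    length L + length u              ≤⟨ +-monoʳ-≤ (length L) (m≤m+n (length u) (length R)) ⟩
    length L + (length u + length R) ≡⟨ cong (length L +_) (length-++ u) ⟨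
    length L + length (u ++ R)       ≡⟨ length-++ L ⟨
    length (L ++ u ++ R)             ∎
    where open ≤-Reasoning
  agree : ∀ j → j < length u → t (length L + j) ≡ at u j
  agree j j<|u| = begin
    t (length L + j)                 ≡⟨ t≡at-τpow0 k (subst (λ x → length L + j < length x) (sym e) (inside j<|u|)) ⟩
    at (τpow0 k) (length L + j)      ≡⟨ cong (λ x → at x (length L + j)) e ⟩
    at (L ++ u ++ R) (length L + j)  ≡⟨ at-++ʳ L (u ++ R) j ⟩
    at (u ++ R) j                    ≡⟨ at-++ˡ u R j<|u| ⟩
    at u j                           ∎
    where open ≡-Reasoning

count-++ : ∀ x u v → count x (u ++ v) ≡ count x u + count x v
count-++ x [] v = refl
count-++ l0 (l0 ∷ u) v = cong suc (count-++ l0 u v)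
count-++ l0 (l1 ∷ u) v = count-++ l0 u v
count-++ l0 (l2 ∷ u) v = count-++ l0 u v
count-++ l1 (l0 ∷ u) v = count-++ l1 u v
count-++ l1 (l1 ∷ u) v = cong suc (count-++ l1 u v)
count-++ l1 (l2 ∷ u) v = count-++ l1 u v
count-++ l2 (l0 ∷ u) v = count-++ l2 u v
count-++ l2 (l1 ∷ u) v = count-++ l2 u v
count-++ l2 (l2 ∷ u) v = cong suc (count-++ l2 u v)

count-singleton≤1 : ∀ x c → count x (c ∷ []) ≤ 1
count-singleton≤1 l0 l0 = ≤-refl
count-singleton≤1 l0 l1 = z≤n
count-singleton≤1 l0 l2 = z≤n
count-singleton≤1 l1 l0 = z≤n
count-singleton≤1 l1 l1 = ≤-refl
count-singleton≤1 l1 l2 = z≤n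
count-singleton≤1 l2 l0 = z≤n
count-singleton≤1 l2 l1 = z≤n
count-singleton≤1 l2 l2 = ≤-refl

count-singleton-injective : count a (a ∷ []) ≡ count a (b ∷ []) → a ≡ b
count-singleton-injective {l0} {l0} _ = refl
count-singleton-injective {l1} {l1} _ = refl
count-singleton-injective {l2} {l2} _ = refl
count-singleton-injective {l0} {l1} ()
count-singleton-injective {l0} {l2} ()
count-singleton-injective {l1} {l0} ()
count-singleton-injective {l1} {l2} ()
count-singleton-injective {l2} {l0} ()
count-singleton-injective {l2} {l1} ()

Ψ≡⇒count≡ : ∀ u v → Ψ u ≡ Ψ v → ∀ x → count x u ≡ count x v
Ψ≡⇒count≡ u v e l0 = cong proj₁ e
Ψ≡⇒count≡ u v e l1 = cong (λ p → proj₁ (proj₂ p)) e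
Ψ≡⇒count≡ u v e l2 = cong (λ p → proj₂ (proj₂ p)) e

Ψ-∷ʳ-injective : ∀ w → Ψ (w ∷ʳ a) ≡ Ψ (w ∷ʳ b) → a ≡ b
Ψ-∷ʳ-injective {a} {b} w e = count-singleton-injective (+-cancelˡ-≡ (count a w) _ _ (begin
  count a w + count a (a ∷ [])  ≡⟨ count-++ a w (a ∷ []) ⟨
  count a (w ∷ʳ a)              ≡⟨ Ψ≡⇒count≡ (w ∷ʳ a) (w ∷ʳ b) e a ⟩
  count a (w ∷ʳ b)              ≡⟨ count-++ a w (b ∷ []) ⟩
  count a w + count a (b ∷ [])  ∎))
  where open ≡-Reasoning

count-∷ʳ-bounds : ∀ x w c → count x w ≤ count x (w ∷ʳ c) × count x (w ∷ʳ c) ≤ suc (count x w)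
count-∷ʳ-bounds x w c rewrite count-++ x w (c ∷ []) =
  m≤m+n (count x w) _ , ≤-trans (+-monoʳ-≤ (count x w) (count-singleton≤1 x c)) (≤-reflexive (+-comm (count x w) 1))

Ψ-∷ʳ-separated : ∀ x u w → count x u < count x w ⊎ suc (count x w) < count x u → ∀ c → Ψ u ≢ Ψ (w ∷ʳ c)
Ψ-∷ʳ-separated x u w outside c e with count-∷ʳ-bounds x w c | outside
... | lower , _ | inj₁ u<w = <⇒≱ u<w (≤-trans lower (≤-reflexive (sym (Ψ≡⇒count≡ u (w ∷ʳ c) e x))))
... | _ , upper | inj₂ w<u = <⇒≱ w<u (≤-trans (≤-reflexive (Ψ≡⇒count≡ u (w ∷ʳ c) e x)) upper)

factorAt-prefix : ∀ p {m n} → m ≤ n → ∃[ z ] (factorAt p n ≡ factorAt p m ++ z)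
factorAt-prefix p {m} {n} m≤n = rest , (begin
  factorAt p n                                 ≡⟨ cong (factorAt p) (m+[n∸m]≡n m≤n) ⟨
  factorAt p (m + (n ∸ m))                     ≡⟨ factorAt-applyUpTo p (m + (n ∸ m)) ⟩
  applyUpTo (λ j → t (p + j)) (m + (n ∸ m))    ≡⟨ applyUpTo-++ (λ j → t (p + j)) m (n ∸ m) ⟩
  applyUpTo (λ j → t (p + j)) m ++ rest        ≡⟨ cong (_++ rest) (factorAt-applyUpTo p m) ⟨
  factorAt p m ++ rest                         ∎)
  where
  open ≡-Reasoning
  rest = applyUpTo (λ j → t (p + (m + j))) (n ∸ m)

count-factorAt-mono : ∀ x p {m n} → m ≤ n → count x (factorAt p m) ≤ count x (factorAt p n)
count-factorAt-mono x p {m} m≤n with factorAt-prefix p m≤n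
... | z , e = ≤-trans (m≤m+n _ _) (≤-reflexive (trans (sym (count-++ x (factorAt p m) z)) (cong (count x) (sym e))))

letter : Fin 3 → Letter
letter F.zero = l0
letter (F.suc F.zero) = l1
letter (F.suc (F.suc F.zero)) = l2

index : Letter → Fin 3
index l0 = F.zero
index l1 = F.suc F.zero
index l2 = F.suc (F.suc F.zero)

index-letter : ∀ i → index (letter i) ≡ i
index-letter F.zero = refl
index-letter (F.suc F.zero) = refl
index-letter (F.suc (F.suc F.zero)) = refl

ρ≥4 : ∀ n w p (P : Letter → ℕ) → (∀ c → Ψ (factorAt (P c) n) ≡ Ψ (w ∷ʳ c)) →
  (∀ c → Ψ (factorAt p n) ≢ Ψ (w ∷ʳ c)) → ρ≥ n 4
ρ≥4 n w p P at-P new = position , injective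
  where
  position : Fin 4 → ℕ
  position F.zero = p
  position (F.suc i) = P (letter i)
  injective : ∀ i j → Ψ (factorAt (position i) n) ≡ Ψ (factorAt (position j) n) → i ≡ j
  injective F.zero F.zero _ = refl
  injective F.zero (F.suc j) e = ⊥-elim (new (letter j) (trans e (at-P (letter j))))
  injective (F.suc i) F.zero e = ⊥-elim (new (letter i) (trans (sym e) (at-P (letter i))))
  injective (F.suc i) (F.suc j) e = cong F.suc (begin
    i                 ≡⟨ index-letter i ⟨
    index (letter i)  ≡⟨ cong index (Ψ-∷ʳ-injective w (trans (sym (at-P (letter i))) (trans e (at-P (letter j))))) ⟩
    index (letter j)  ≡⟨ index-letter j ⟩
    j                 ∎)
    where open ≡-Reasoning

count-factorAt-≤ : ∀ x p {n} v → factorAt p (length v) ≡ v → n ≤ length v → count x (factorAt p n) ≤ count x v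
count-factorAt-≤ x p {n} v v-at-p n≤|v| = subst (count x (factorAt p n) ≤_) (cong (count x) v-at-p) (count-factorAt-mono x p n≤|v|)

count-factorAt-≥ : ∀ x p {n} v → factorAt p (length v) ≡ v → length v ≤ n → count x v ≤ count x (factorAt p n)
count-factorAt-≥ x p {n} v v-at-p |v|≤n = subst (_≤ count x (factorAt p n)) (cong (count x) v-at-p) (count-factorAt-mono x p |v|≤n)

separating-letter : ∀ p n v w → factorAt p (length v) ≡ v →
  (n ≤ length v × (Ψ₀ v < Ψ₀ w ⊎ Ψ₁ v < Ψ₁ w)) ⊎ (length v ≤ n × (Ψ₀ w + 2 ≤ Ψ₀ v ⊎ Ψ₁ w + 2 ≤ Ψ₁ v)) →
  ∃[ x ] (count x (factorAt p n) < count x w ⊎ suc (count x w) < count x (factorAt p n))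
separating-letter p n v w v-at-p (inj₁ (n≤|v| , inj₁ v<w)) = l0 , inj₁ (≤-<-trans (count-factorAt-≤ l0 p v v-at-p n≤|v|) v<w)
separating-letter p n v w v-at-p (inj₁ (n≤|v| , inj₂ v<w)) = l1 , inj₁ (≤-<-trans (count-factorAt-≤ l1 p v v-at-p n≤|v|) v<w)
separating-letter p n v w v-at-p (inj₂ (|v|≤n , inj₁ w+2≤v)) =
  l0 , inj₂ (≤-trans (subst (_≤ count l0 v) (+-comm (count l0 w) 2) w+2≤v) (count-factorAt-≥ l0 p v v-at-p |v|≤n))
separating-letter p n v w v-at-p (inj₂ (|v|≤n , inj₂ w+2≤v)) =
  l1 , inj₂ (≤-trans (subst (_≤ count l1 v) (+-comm (count l1 w) 2) w+2≤v) (count-factorAt-≥ l1 p v v-at-p |v|≤n))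

lemma4 : (n : ℕ) → 1 ≤ n →
    (w : List Letter) → length w ≡ n ∸ 1 → IsFactor w → RightSpecial w →
    (v : List Letter) → IsFactor v →
    ((n ≤ length v × (Ψ₀ v < Ψ₀ w ⊎ Ψ₁ v < Ψ₁ w))
      ⊎ (length v ≤ n × (Ψ₀ w + 2 ≤ Ψ₀ v ⊎ Ψ₁ w + 2 ≤ Ψ₁ v))) →
    ρ≥ n 4
lemma4 (suc m) _ w |w|≡m _ (a , b , a≢b , wa , wb) v (p , v-at-p) hyp =
  let x , separated = separating-letter p (suc m) v w v-at-p hyp in
  ρ≥4 (suc m) w p position at-position (Ψ-∷ʳ-separated x (factorAt p (suc m)) w separated)
  where
  extension : ∀ c → IsFactor (w ∷ʳ c)
  extension c = IsFactor′⇒IsFactor (twoExtensions⇒allExtensions w (length-wellFounded w) a≢b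
                  (IsFactor⇒IsFactor′ wa) (IsFactor⇒IsFactor′ wb) c)
  position : Letter → ℕ
  position c = proj₁ (extension c)
  at-position : ∀ c → Ψ (factorAt (position c) (suc m)) ≡ Ψ (w ∷ʳ c)
  at-position c = cong Ψ (subst (λ n → factorAt (position c) n ≡ w ∷ʳ c) |wc|≡1+m (proj₂ (extension c)))
    where |wc|≡1+m = trans (length-++ w) (trans (cong (_+ 1) |w|≡m) (+-comm m 1))
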